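{- Let $t\geq s\geq 1$ and $\Delta\geq 1$ be integers. For all graphs $G$ and $H$ where $G$ contains no subgraph isomorphic to $K_{s,t}$ and $H$ has maximum degree $\Delta$, the strong product $G\boxtimes H$ contains no subgraph isomorphic to $K_{(s-1)(\Delta+1)+1,\,(s+t)(\Delta+1)}$. Moreover, for every integer $n\geq 1$ there exist a graph $\tilde G$ with no $K_{s,t}$ subgraph and a graph $\tilde H$ with maximum degree $\Delta$ such that $K_{(s-1)(\Delta+1),\,n}$ is a subgraph of $\tilde G\boxtimes\tilde H$.
   Context: All graphs are finite and simple. The strong product $G\boxtimes H$ has vertex set $V(G)\times V(H)$, with distinct $(a,v),(b,u)$ adjacent iff ($a=b$ or $ab\in E(G)$) and ($u=v$ or $uv\in E(H)$). $K_{p,q}$ is the complete bipartite graph with parts of sizes $p$ and $q$. -}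

module Defs where

open import Data.Nat using (ℕ; _≤_)
open import Data.Bool using (Bool; true; false; if_then_else_)
open import Data.Fin using (Fin)
open import Data.List using (List; map; allFin)
open import Data.Nat.ListAction using (sum)
open import Data.Sum using (_⊎_; inj₁; inj₂)
open import Data.Product using (_×_; Σ; ∃; _,_)
open import Relation.Binary.PropositionalEquality using (_≡_; _≢_)
open import Function.Definitions using (Injective)

record Graph : Set where
  field
    n     : ℕ
    adj   : Fin n → Fin n → Bool
    sym   : ∀ i j → adj i j ≡ adj j i
    irr   : ∀ i → adj i i ≡ false
open Graph public

Vtx : Graph → Set
Vtx G = Fin (n G)

Adj : (G : Graph) → Vtx G → Vtx G → Set
Adj G u v = adj G u v ≡ true

degree : (G : Graph) → Vtx G → ℕ
degree G v = sum (map (λ w → if adj G v w then 1 else 0) (allFin (n G)))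

HasMaxDegree : Graph → ℕ → Set
HasMaxDegree G Δ = (∀ v → degree G v ≤ Δ) × (∃ λ v → degree G v ≡ Δ)

ContainsKpq : {V : Set} → (V → V → Set) → ℕ → ℕ → Set
ContainsKpq {V} E p q =
  Σ (Fin p ⊎ Fin q → V) λ f →
    Injective _≡_ _≡_ f × (∀ (i : Fin p) (j : Fin q) → E (f (inj₁ i)) (f (inj₂ j)))

HasKpq : Graph → ℕ → ℕ → Set
HasKpq G p q = ContainsKpq (Adj G) p q

StrongAdj : (G H : Graph) → Vtx G × Vtx H → Vtx G × Vtx H → Set
StrongAdj G H (a , v) (b , u) =
  ((a , v) ≢ (b , u)) × ((a ≡ b ⊎ Adj G a b) × (v ≡ u ⊎ Adj H v u))

StrongHasKpq : Graph → Graph → ℕ → ℕ → Set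
StrongHasKpq G H p q = ContainsKpq (StrongAdj G H) p q

{-# OPTIONS --safe #-}
-- If K_{P,Q} lies in G ⊠ H, every vertex of one side is strongly adjacent to a
-- fixed vertex of the other side, so its H-coordinate lies in a closed neighbourhood
-- of at most Δ + 1 vertices.  Hence the G-projections of the two sides contain at
-- least ⌈P/(Δ+1)⌉ = s and ⌈Q/(Δ+1)⌉ = s + t distinct vertices.  Taking s vertices of
-- the first projection and t vertices of the second avoiding them gives a K_{s,t}
-- in G, because distinct G-coordinates of strongly adjacent vertices are adjacent.
-- Conversely, in K_{s-1,n} ⊠ K_{Δ+1} every (x, c) with x in the small part is
-- adjacent to every (y, c₀) with y in the large part, while K_{s-1,n} has no K_{s,t}
-- as both sides of a K_{s,t} in it would need at least s vertices, yet one side lies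
-- in the part of size s - 1.

module Submission where

open import Defs
open import Data.Bool using (Bool; true; false; not; _xor_; if_then_else_)
open import Data.Bool.Properties using (xor-comm; xor-same)
open import Data.Fin using (Fin; zero; suc; inject≤; _↑ˡ_; _↑ʳ_; splitAt; combine; remQuot; _≟_)
open import Data.Fin.Properties
  using (suc-injective; any?; injective⇒≤; inject≤-injective; ↑ˡ-injective; ↑ʳ-injective;
         splitAt-↑ˡ; splitAt-↑ʳ; combine-injective; combine-remQuot)
open import Data.Fin.Subset using (Subset; inside; outside; _∈_; _⊆_; _∩_; _∪_; ∁; ⁅_⁆; ∣_∣; ⊤; ⊥)
open import Data.Fin.Subset.Properties
  using (_∈?_; ∣p∣≤∣x∷p∣; ⊥⊆; ∣⊥∣≡0; s⊆s; p⊆q⇒∣p∣≤∣q∣; p⊆p∪q; q⊆p∪q; x∈⁅x⁆; ∣⁅x⁆∣≡1;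
         p∩q⊆p; x∈p∩q⁺; x∈p∩q⁻; x∉p⇒x∈∁p; x∈∁p⇒x∉p)
import Data.List as List
open import Data.List.Properties using (map-tabulate)
open import Data.Nat using (ℕ; zero; suc; _≤_; _<_; _+_; _*_; _∸_; z<s; s≤s; s≤s⁻¹; ≢-nonZero)
open import Data.Nat.ListAction using (sum)
open import Data.Nat.Properties
  using (≤-refl; ≤-reflexive; ≤-trans; <-≤-trans; <⇒≱; +-suc; +-comm; +-monoʳ-≤; +-monoˡ-≤;
         +-cancelˡ-≤; *-monoʳ-≤; *-cancelʳ-<; *-cancelʳ-≤; m<m+n; m+1+n≢0; m+n∸n≡m; module ≤-Reasoning)
open import Data.Product using (_×_; Σ; ∃; _,_; proj₁; proj₂; map₁; uncurry)
open import Data.Product.Properties using (×-≡,≡→≡)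
open import Data.Sum using (_⊎_; inj₁; inj₂; [_,_]′)
import Data.Sum as Sum
open import Data.Sum.Properties using (inj₁-injective; inj₂-injective)
open import Data.Vec using ([]; _∷_; lookup; tabulate; _++_)
open import Data.Vec.Base using (here; there)
open import Data.Vec.Properties
  using (lookup⇒[]=; []=⇒lookup; lookup∘tabulate; lookup-++ˡ; lookup-++ʳ; lookup-replicate)
open import Function using (_∘_; id; mk⇔)
open import Function.Definitions using (Injective)
open import Relation.Binary.PropositionalEquality hiding (sym)
import Relation.Binary.PropositionalEquality as ≡
open import Relation.Nullary using (¬_; yes; no; does; contradiction)
open import Relation.Nullary.Decidable using (dec-true; does-⇔)

enumerate : ∀ {n} (p : Subset n) → Fin ∣ p ∣ → Fin n
enumerate (inside  ∷ p) zero    = zero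
enumerate (inside  ∷ p) (suc i) = suc (enumerate p i)
enumerate (outside ∷ p) i       = suc (enumerate p i)

enumerate-∈ : ∀ {n} (p : Subset n) i → enumerate p i ∈ p
enumerate-∈ (inside  ∷ p) zero    = here
enumerate-∈ (inside  ∷ p) (suc i) = there (enumerate-∈ p i)
enumerate-∈ (outside ∷ p) i       = there (enumerate-∈ p i)

enumerate-injective : ∀ {n} (p : Subset n) → Injective _≡_ _≡_ (enumerate p)
enumerate-injective (inside  ∷ p) {zero}  {zero}  _  = refl
enumerate-injective (inside  ∷ p) {suc i} {suc j} eq =
  cong suc (enumerate-injective p (suc-injective eq))
enumerate-injective (outside ∷ p)                 eq = enumerate-injective p (suc-injective eq)

rank : ∀ {n} (p : Subset n) {x} → x ∈ p → Fin ∣ p ∣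
rank (inside  ∷ p) here        = zero
rank (inside  ∷ p) (there x∈p) = suc (rank p x∈p)
rank (outside ∷ p) (there x∈p) = rank p x∈p

enumerate-rank : ∀ {n} (p : Subset n) {x} (x∈p : x ∈ p) → enumerate p (rank p x∈p) ≡ x
enumerate-rank (inside  ∷ p) here        = refl
enumerate-rank (inside  ∷ p) (there x∈p) = cong suc (enumerate-rank p x∈p)
enumerate-rank (outside ∷ p) (there x∈p) = cong suc (enumerate-rank p x∈p)

rank-injective : ∀ {n} (p : Subset n) {x y} (x∈p : x ∈ p) (y∈p : y ∈ p) →
                 rank p x∈p ≡ rank p y∈p → x ≡ y
rank-injective p {x} {y} x∈p y∈p eq = begin
  x                        ≡⟨ enumerate-rank p x∈p ⟨
  enumerate p (rank p x∈p) ≡⟨ cong (enumerate p) eq ⟩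
  enumerate p (rank p y∈p) ≡⟨ enumerate-rank p y∈p ⟩
  y                        ∎
  where open ≡-Reasoning

injective⇒≤∣p∣ : ∀ {m n} {f : Fin m → Fin n} (p : Subset n) →
                 Injective _≡_ _≡_ f → (∀ i → f i ∈ p) → m ≤ ∣ p ∣
injective⇒≤∣p∣ p f-inj f∈p =
  injective⇒≤ {f = λ i → rank p (f∈p i)} (f-inj ∘ rank-injective p (f∈p _) (f∈p _))

injective⇒≤∣p∣*∣q∣ : ∀ {m a b} {f : Fin m → Fin a × Fin b} (p : Subset a) (q : Subset b) →
                     Injective _≡_ _≡_ f → (∀ i → proj₁ (f i) ∈ p) → (∀ i → proj₂ (f i) ∈ q) →
                     m ≤ ∣ p ∣ * ∣ q ∣
injective⇒≤∣p∣*∣q∣ p q f-inj f₁∈p f₂∈q = injective⇒≤ {f = code} code-injective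
  where
  code = λ i → combine (rank p (f₁∈p i)) (rank q (f₂∈q i))
  code-injective : Injective _≡_ _≡_ code
  code-injective eq with combine-injective _ _ _ _ eq
  ... | eq₁ , eq₂ = f-inj (×-≡,≡→≡ (rank-injective p _ _ eq₁ , rank-injective q _ _ eq₂))

∣p∪q∣≤∣p∣+∣q∣ : ∀ {n} (p q : Subset n) → ∣ p ∪ q ∣ ≤ ∣ p ∣ + ∣ q ∣
∣p∪q∣≤∣p∣+∣q∣ []            []            = ≤-refl
∣p∪q∣≤∣p∣+∣q∣ (inside  ∷ p) (x ∷ q)       =
  s≤s (≤-trans (∣p∪q∣≤∣p∣+∣q∣ p q) (+-monoʳ-≤ ∣ p ∣ (∣p∣≤∣x∷p∣ x q)))
∣p∪q∣≤∣p∣+∣q∣ (outside ∷ p) (inside  ∷ q) =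
  ≤-trans (s≤s (∣p∪q∣≤∣p∣+∣q∣ p q)) (≤-reflexive (≡.sym (+-suc ∣ p ∣ ∣ q ∣)))
∣p∪q∣≤∣p∣+∣q∣ (outside ∷ p) (outside ∷ q) = ∣p∪q∣≤∣p∣+∣q∣ p q

∣p∣≤∣p∩∁q∣+∣q∣ : ∀ {n} (p q : Subset n) → ∣ p ∣ ≤ ∣ p ∩ ∁ q ∣ + ∣ q ∣
∣p∣≤∣p∩∁q∣+∣q∣ p q = ≤-trans (p⊆q⇒∣p∣≤∣q∣ p⊆[p∩∁q]∪q) (∣p∪q∣≤∣p∣+∣q∣ (p ∩ ∁ q) q)
  where
  p⊆[p∩∁q]∪q : p ⊆ (p ∩ ∁ q) ∪ q
  p⊆[p∩∁q]∪q {x} x∈p with x ∈? q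
  ... | yes x∈q = q⊆p∪q (p ∩ ∁ q) q x∈q
  ... | no  x∉q = p⊆p∪q q (x∈p∩q⁺ (x∈p , x∉p⇒x∈∁p x∉q))

subsetOfSize : ∀ {n k} (p : Subset n) → k ≤ ∣ p ∣ → ∃ λ q → q ⊆ p × ∣ q ∣ ≡ k
subsetOfSize {n} {zero}  p             _     = ⊥ , ⊥⊆ , ∣⊥∣≡0 n
subsetOfSize {k = suc k} (inside  ∷ p) k<∣p∣ =
  let q , q⊆p , ∣q∣≡k = subsetOfSize p (s≤s⁻¹ k<∣p∣) in inside ∷ q , s⊆s q⊆p , cong suc ∣q∣≡k
subsetOfSize {k = suc k} (outside ∷ p) k<∣p∣ =
  let q , q⊆p , ∣q∣≡k = subsetOfSize p k<∣p∣ in outside ∷ q , s⊆s q⊆p , ∣q∣≡k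

tabulate-∈⁺ : ∀ {n} {b : Fin n → Bool} {x} → b x ≡ true → x ∈ tabulate b
tabulate-∈⁺ {b = b} {x} bx≡true =
  lookup⇒[]= x (tabulate b) (trans (lookup∘tabulate b x) bx≡true)

tabulate-∈⁻ : ∀ {n} {b : Fin n → Bool} {x} → x ∈ tabulate b → b x ≡ true
tabulate-∈⁻ {b = b} {x} x∈ = trans (≡.sym (lookup∘tabulate b x)) ([]=⇒lookup x∈)

image : ∀ {m n} → (Fin m → Fin n) → Subset n
image f = tabulate λ x → does (any? λ i → f i ≟ x)

image-∈⁺ : ∀ {m n} (f : Fin m → Fin n) i → f i ∈ image f
image-∈⁺ f i = tabulate-∈⁺ (dec-true (any? λ j → f j ≟ f i) (i , refl))

image-∈⁻ : ∀ {m n} (f : Fin m → Fin n) {x} → x ∈ image f → ∃ λ i → f i ≡ x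
image-∈⁻ f {x} x∈ with any? (λ i → f i ≟ x) | tabulate-∈⁻ x∈
... | yes f⁻¹x | _  = f⁻¹x
... | no  _    | ()

ContainsKpq-intro : ∀ {V : Set} {E : V → V → Set} {p q} (a : Fin p → V) (b : Fin q → V) →
                    Injective _≡_ _≡_ a → Injective _≡_ _≡_ b → (∀ i j → a i ≢ b j) →
                    (∀ i j → E (a i) (b j)) → ContainsKpq E p q
ContainsKpq-intro a b a-inj b-inj a≢b a~b = [ a , b ]′ , [a,b]-injective , a~b
  where
  [a,b]-injective : Injective _≡_ _≡_ [ a , b ]′
  [a,b]-injective {inj₁ i} {inj₁ i′} eq = cong inj₁ (a-inj eq)
  [a,b]-injective {inj₁ i} {inj₂ j}  eq = contradiction eq (a≢b i j)
  [a,b]-injective {inj₂ j} {inj₁ i}  eq = contradiction (≡.sym eq) (a≢b i j)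
  [a,b]-injective {inj₂ j} {inj₂ j′} eq = cong inj₂ (b-inj eq)

ContainsKpq-fromSubsets : ∀ {n k l} {E : Fin n → Fin n → Set} (p q : Subset n) →
                          k ≤ ∣ p ∣ → k + l ≤ ∣ q ∣ →
                          (∀ {x y} → x ∈ p → y ∈ q → x ≢ y → E x y) → ContainsKpq E k l
ContainsKpq-fromSubsets {k = k} {l} {E} p q k≤∣p∣ k+l≤∣q∣ E-pq with subsetOfSize p k≤∣p∣
... | S , S⊆p , ∣S∣≡k =
  ContainsKpq-intro {E = E} a b a-injective b-injective a≢b
    λ i j → E-pq (S⊆p (a∈S i)) (b∈q j) (a≢b i j)
  where
  T = q ∩ ∁ S

  l≤∣T∣ : l ≤ ∣ T ∣
  l≤∣T∣ = +-cancelˡ-≤ k l ∣ T ∣ (begin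
    k + l         ≤⟨ k+l≤∣q∣ ⟩
    ∣ q ∣         ≤⟨ ∣p∣≤∣p∩∁q∣+∣q∣ q S ⟩
    ∣ T ∣ + ∣ S ∣ ≡⟨ cong (∣ T ∣ +_) ∣S∣≡k ⟩
    ∣ T ∣ + k     ≡⟨ +-comm ∣ T ∣ k ⟩
    k + ∣ T ∣     ∎)
    where open ≤-Reasoning

  k≤∣S∣ : k ≤ ∣ S ∣
  k≤∣S∣ = ≤-reflexive (≡.sym ∣S∣≡k)

  a : Fin k → Fin _
  a i = enumerate S (inject≤ i k≤∣S∣)

  b : Fin l → Fin _
  b j = enumerate T (inject≤ j l≤∣T∣)

  a∈S : ∀ i → a i ∈ S
  a∈S i = enumerate-∈ S _

  b∈T : ∀ j → b j ∈ T
  b∈T j = enumerate-∈ T _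

  b∈q : ∀ j → b j ∈ q
  b∈q j = p∩q⊆p q (∁ S) (b∈T j)

  a-injective : Injective _≡_ _≡_ a
  a-injective = inject≤-injective _ _ _ _ ∘ enumerate-injective S

  b-injective : Injective _≡_ _≡_ b
  b-injective = inject≤-injective _ _ _ _ ∘ enumerate-injective T

  a≢b : ∀ i j → a i ≢ b j
  a≢b i j a≡b = x∈∁p⇒x∉p (proj₂ (x∈p∩q⁻ q (∁ S) (b∈T j))) (subst (_∈ S) a≡b (a∈S i))

Adj-sym : ∀ G {u v} → Adj G u v → Adj G v u
Adj-sym G {u} {v} u~v = trans (Graph.sym G v u) u~v

≡⊎Adj-sym : ∀ G {u v} → u ≡ v ⊎ Adj G u v → v ≡ u ⊎ Adj G v u
≡⊎Adj-sym G = Sum.map ≡.sym (Adj-sym G)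

neighbours : (G : Graph) → Vtx G → Subset (n G)
neighbours G v = tabulate (adj G v)

closedNeighbourhood : (G : Graph) → Vtx G → Subset (n G)
closedNeighbourhood G v = neighbours G v ∪ ⁅ v ⁆

degree≡∣neighbours∣ : ∀ G v → degree G v ≡ ∣ neighbours G v ∣
degree≡∣neighbours∣ G v =
  trans (cong sum (map-tabulate id (indicator ∘ adj G v))) (sum-indicator (adj G v))
  where
  indicator : Bool → ℕ
  indicator b = if b then 1 else 0

  sum-indicator : ∀ {m} (b : Fin m → Bool) → sum (List.tabulate (indicator ∘ b)) ≡ ∣ tabulate b ∣
  sum-indicator {zero}  b = refl
  sum-indicator {suc m} b with b zero
  ... | true  = cong suc (sum-indicator (b ∘ suc))
  ... | false = sum-indicator (b ∘ suc)

∣closedNeighbourhood∣≤degree+1 : ∀ G v → ∣ closedNeighbourhood G v ∣ ≤ degree G v + 1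
∣closedNeighbourhood∣≤degree+1 G v = begin
  ∣ neighbours G v ∪ ⁅ v ⁆ ∣       ≤⟨ ∣p∪q∣≤∣p∣+∣q∣ (neighbours G v) ⁅ v ⁆ ⟩
  ∣ neighbours G v ∣ + ∣ ⁅ v ⁆ ∣  ≡⟨ cong₂ _+_ (≡.sym (degree≡∣neighbours∣ G v)) (∣⁅x⁆∣≡1 v) ⟩
  degree G v + 1                 ∎
  where open ≤-Reasoning

closedNeighbourhood-∈ : ∀ G {u v} → u ≡ v ⊎ Adj G u v → u ∈ closedNeighbourhood G v
closedNeighbourhood-∈ G {v = v} (inj₁ refl) = q⊆p∪q (neighbours G v) ⁅ v ⁆ (x∈⁅x⁆ v)
closedNeighbourhood-∈ G {v = v} (inj₂ u~v)  = p⊆p∪q ⁅ v ⁆ (tabulate-∈⁺ (Adj-sym G u~v))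

StrongAdj-sym : ∀ G H {x y} → StrongAdj G H x y → StrongAdj G H y x
StrongAdj-sym G H (x≢y , a~b , v~u) = ≢-sym x≢y , ≡⊎Adj-sym G a~b , ≡⊎Adj-sym H v~u

commonStrongNeighbour⇒≤ : ∀ G H {Δ N} → (∀ v → degree H v ≤ Δ) →
                          {f : Fin N → Vtx G × Vtx H} → Injective _≡_ _≡_ f →
                          (z : Vtx G × Vtx H) → (∀ i → StrongAdj G H (f i) z) →
                          N ≤ ∣ image (proj₁ ∘ f) ∣ * (Δ + 1)
commonStrongNeighbour⇒≤ G H {Δ} {N} deg≤Δ {f} f-inj (_ , v) f~z = begin
  N                                   ≤⟨ injective⇒≤∣p∣*∣q∣ X (closedNeighbourhood H v) f-inj
                                           (image-∈⁺ (proj₁ ∘ f)) f₂∈N[v] ⟩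
  ∣ X ∣ * ∣ closedNeighbourhood H v ∣ ≤⟨ *-monoʳ-≤ ∣ X ∣ ∣N[v]∣≤Δ+1 ⟩
  ∣ X ∣ * (Δ + 1)                     ∎
  where
  open ≤-Reasoning
  X = image (proj₁ ∘ f)

  f₂∈N[v] : ∀ i → proj₂ (f i) ∈ closedNeighbourhood H v
  f₂∈N[v] i = closedNeighbourhood-∈ H (proj₂ (proj₂ (f~z i)))

  ∣N[v]∣≤Δ+1 : ∣ closedNeighbourhood H v ∣ ≤ Δ + 1
  ∣N[v]∣≤Δ+1 = ≤-trans (∣closedNeighbourhood∣≤degree+1 H v) (+-monoˡ-≤ 1 (deg≤Δ v))

StrongHasKpq⇒HasKpq : ∀ G H {Δ s t} → (∀ v → degree H v ≤ Δ) →
                      StrongHasKpq G H (s * (Δ + 1) + 1) ((suc s + t) * (Δ + 1)) → HasKpq G (suc s) t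
StrongHasKpq⇒HasKpq G H {Δ} {s} {t} deg≤Δ (f , f-inj , f~) =
  ContainsKpq-fromSubsets {E = Adj G} X Y s<∣X∣ s+t≤∣Y∣ X×Y-adjacent
  where
  a = f ∘ inj₁
  b = f ∘ inj₂

  a₀ : Fin (s * (Δ + 1) + 1)
  a₀ = s * (Δ + 1) ↑ʳ zero
  b₀ : Fin ((suc s + t) * (Δ + 1))
  b₀ = (Δ ↑ʳ zero) ↑ˡ (s + t) * (Δ + 1)

  X = image (proj₁ ∘ a)
  Y = image (proj₁ ∘ b)

  s<∣X∣ : s < ∣ X ∣
  s<∣X∣ = *-cancelʳ-< (Δ + 1) s ∣ X ∣ (<-≤-trans (m<m+n (s * (Δ + 1)) z<s)
    (commonStrongNeighbour⇒≤ G H deg≤Δ (inj₁-injective ∘ f-inj) (b b₀) λ i → f~ i b₀))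

  s+t≤∣Y∣ : suc s + t ≤ ∣ Y ∣
  s+t≤∣Y∣ = *-cancelʳ-≤ (suc s + t) ∣ Y ∣ (Δ + 1) {{≢-nonZero (m+1+n≢0 Δ)}}
    (commonStrongNeighbour⇒≤ G H deg≤Δ (inj₂-injective ∘ f-inj) (a a₀)
      λ j → StrongAdj-sym G H (f~ a₀ j))

  X×Y-adjacent : ∀ {x y} → x ∈ X → y ∈ Y → x ≢ y → Adj G x y
  X×Y-adjacent x∈X y∈Y x≢y with image-∈⁻ (proj₁ ∘ a) x∈X | image-∈⁻ (proj₁ ∘ b) y∈Y
  ... | i , refl | j , refl =
    [ (λ x≡y → contradiction x≡y x≢y) , id ]′ (proj₁ (proj₂ (f~ i j)))

complete : ℕ → Graph
complete n = record
  { n   = n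
  ; adj = λ x y → not (does (x ≟ y))
  ; sym = λ x y → cong not (does-⇔ (mk⇔ ≡.sym ≡.sym) (x ≟ y) (y ≟ x))
  ; irr = λ x → cong not (dec-true (x ≟ x) refl)
  }

complete-≡⊎Adj : ∀ {n} (x y : Fin n) → x ≡ y ⊎ Adj (complete n) x y
complete-≡⊎Adj x y with x ≟ y
... | yes x≡y = inj₁ x≡y
... | no  _   = inj₂ refl

complete-degree : ∀ {n} (v : Fin n) → degree (complete n) v ≡ n ∸ 1
complete-degree {n} v = trans (degree≡∣neighbours∣ (complete n) v) (∣others∣ v)
  where
  ∣all∣ : ∀ m → ∣ tabulate {n = m} (λ _ → inside) ∣ ≡ m
  ∣all∣ zero    = refl
  ∣all∣ (suc m) = cong suc (∣all∣ m)

  ∣others∣ : ∀ {m} (v : Fin m) → ∣ tabulate (λ w → not (does (v ≟ w))) ∣ ≡ m ∸ 1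
  ∣others∣ {suc m}       zero    = ∣all∣ m
  ∣others∣ {suc (suc m)} (suc v) = cong suc (∣others∣ v)

complete-HasMaxDegree : ∀ Δ → HasMaxDegree (complete (Δ + 1)) Δ
complete-HasMaxDegree Δ = (λ v → ≤-reflexive (degree≡Δ v)) , Δ ↑ʳ zero , degree≡Δ (Δ ↑ʳ zero)
  where
  degree≡Δ : ∀ v → degree (complete (Δ + 1)) v ≡ Δ
  degree≡Δ v = trans (complete-degree v) (m+n∸n≡m Δ 1)

bipartite : ∀ {n} → Subset n → Graph
bipartite {n} L = record
  { n   = n
  ; adj = λ x y → lookup L x xor lookup L y
  ; sym = λ x y → xor-comm (lookup L x) (lookup L y)
  ; irr = λ x → xor-same (lookup L x)
  }

bipartite-opposite : ∀ {n} (L : Subset n) {x y} →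
                     Adj (bipartite L) x y → lookup L y ≡ not (lookup L x)
bipartite-opposite L {x} {y} = opposite (lookup L x) (lookup L y)
  where
  opposite : ∀ u w → u xor w ≡ true → w ≡ not u
  opposite false true  _ = refl
  opposite true  false _ = refl

bipartite-Kpq⇒side : ∀ {n p q} (L : Subset n) → HasKpq (bipartite L) (suc p) (suc q) →
                     suc p ≤ ∣ L ∣ ⊎ suc q ≤ ∣ L ∣
bipartite-Kpq⇒side L (f , f-inj , f~) with lookup L (f (inj₁ zero)) in a₀-side
... | true  = inj₁ (injective⇒≤∣p∣ L (inj₁-injective ∘ f-inj) λ i → lookup⇒[]= _ L (a∈L i))
  where
  b₀∉L : lookup L (f (inj₂ zero)) ≡ false
  b₀∉L = trans (bipartite-opposite L (f~ zero zero)) (cong not a₀-side)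
  a∈L : ∀ i → lookup L (f (inj₁ i)) ≡ true
  a∈L i = trans (bipartite-opposite L (Adj-sym (bipartite L) (f~ i zero))) (cong not b₀∉L)
... | false = inj₂ (injective⇒≤∣p∣ L (inj₂-injective ∘ f-inj) λ j → lookup⇒[]= _ L (b∈L j))
  where
  b∈L : ∀ j → lookup L (f (inj₂ j)) ≡ true
  b∈L j = trans (bipartite-opposite L (f~ zero j)) (cong not a₀-side)

completeBipartite : ℕ → ℕ → Graph
completeBipartite r m = bipartite (⊤ {r} ++ ⊥ {m})

lookup-⊤++⊥-↑ˡ : ∀ r m (x : Fin r) → lookup (⊤ {r} ++ ⊥ {m}) (x ↑ˡ m) ≡ true
lookup-⊤++⊥-↑ˡ r m x = trans (lookup-++ˡ ⊤ ⊥ x) (lookup-replicate x inside)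

lookup-⊤++⊥-↑ʳ : ∀ r {m} (y : Fin m) → lookup (⊤ {r} ++ ⊥ {m}) (r ↑ʳ y) ≡ false
lookup-⊤++⊥-↑ʳ r y = trans (lookup-++ʳ (⊤ {r}) ⊥ y) (lookup-replicate y outside)

∣⊤++⊥∣≡ : ∀ r m → ∣ ⊤ {r} ++ ⊥ {m} ∣ ≡ r
∣⊤++⊥∣≡ zero    m = ∣⊥∣≡0 m
∣⊤++⊥∣≡ (suc r) m = cong suc (∣⊤++⊥∣≡ r m)

completeBipartite-noKpq : ∀ {r m p q} → r < p → p ≤ q → ¬ HasKpq (completeBipartite r m) p q
completeBipartite-noKpq {r} {m} {suc p} {suc q} r<p p≤q K
  with bipartite-Kpq⇒side (⊤ {r} ++ ⊥ {m}) K
... | inj₁ p<∣L∣ = <⇒≱ r<p (≤-trans p<∣L∣ (≤-reflexive (∣⊤++⊥∣≡ r m)))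
... | inj₂ q<∣L∣ = <⇒≱ r<p (≤-trans p≤q (≤-trans q<∣L∣ (≤-reflexive (∣⊤++⊥∣≡ r m))))

↑ˡ≢↑ʳ : ∀ {r m} (x : Fin r) (y : Fin m) → x ↑ˡ m ≢ r ↑ʳ y
↑ˡ≢↑ʳ {r} {m} x y eq
  with trans (≡.sym (splitAt-↑ˡ r x m)) (trans (cong (splitAt r) eq) (splitAt-↑ʳ r m y))
... | ()

completeBipartite⊠complete-Kpq : ∀ r m {d} → Fin d →
                                 StrongHasKpq (completeBipartite r m) (complete d) (r * d) m
completeBipartite⊠complete-Kpq r m {d} c₀ =
  ContainsKpq-intro {E = StrongAdj (completeBipartite r m) (complete d)}
    a b a-injective b-injective a≢b a~b
  where
  a : Fin (r * d) → Fin (r + m) × Fin d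
  a = map₁ (_↑ˡ m) ∘ remQuot {r} d

  b : Fin m → Fin (r + m) × Fin d
  b y = r ↑ʳ y , c₀

  a-injective : Injective _≡_ _≡_ a
  a-injective {i} {i′} eq = begin
    i                                  ≡⟨ combine-remQuot {r} d i ⟨
    uncurry combine (remQuot {r} d i)  ≡⟨ cong (uncurry combine) remQuot-i≡remQuot-i′ ⟩
    uncurry combine (remQuot {r} d i′) ≡⟨ combine-remQuot {r} d i′ ⟩
    i′                                 ∎
    where
    open ≡-Reasoning
    remQuot-i≡remQuot-i′ = ×-≡,≡→≡ (↑ˡ-injective m _ _ (cong proj₁ eq) , cong proj₂ eq)

  b-injective : Injective _≡_ _≡_ b
  b-injective eq = ↑ʳ-injective r _ _ (cong proj₁ eq)

  a≢b : ∀ i j → a i ≢ b j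
  a≢b i j = ↑ˡ≢↑ʳ _ j ∘ cong proj₁

  a~b : ∀ i j → StrongAdj (completeBipartite r m) (complete d) (a i) (b j)
  a~b i j = a≢b i j
          , inj₂ (cong₂ _xor_ (lookup-⊤++⊥-↑ˡ r m _) (lookup-⊤++⊥-↑ʳ r j))
          , complete-≡⊎Adj _ c₀

corollary10 : (s t Δ : ℕ) → 1 ≤ s → s ≤ t → 1 ≤ Δ →
    ((G H : Graph) → ¬ HasKpq G s t → HasMaxDegree H Δ →
      ¬ StrongHasKpq G H ((s ∸ 1) * (Δ + 1) + 1) ((s + t) * (Δ + 1)))
    × ((m : ℕ) → 1 ≤ m →
      Σ Graph λ G~ → Σ Graph λ H~ →
        ¬ HasKpq G~ s t × HasMaxDegree H~ Δ × StrongHasKpq G~ H~ ((s ∸ 1) * (Δ + 1)) m)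
corollary10 (suc s) t Δ _ s≤t _ =
  (λ G H noKst (deg≤Δ , _) → noKst ∘ StrongHasKpq⇒HasKpq G H deg≤Δ) ,
  λ m _ → completeBipartite s m , complete (Δ + 1)
        , completeBipartite-noKpq ≤-refl s≤t
        , complete-HasMaxDegree Δ
        , completeBipartite⊠complete-Kpq s m (Δ ↑ʳ zero)
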